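{- Let $k\geq 2$ and $b$ be integers with $k^2+1\leq b\leq k^2+k$, and let $l$ be an integer with $l\geq 3$ if $b=5$ and $l\geq 2$ otherwise. Suppose $x=[0;a_1,a_2,\dots]\in T_b$ and $a_2$ has $l$ digits in base $b$. Then $$a_2=\left\lceil \frac{b^l(b-k^2)}{k}-\frac{b}{k(b-k^2)}\right\rceil-1.$$
   Context: A real number $x$ is a Trott number in base $b$ if $x\in(0,1)$ has an infinite continued fraction expansion $x=[0;a_1,a_2,\dots]$ with all $a_i$ positive integers and the base-$b$ expansion of $x$ is $(0.\hat{a}_1\hat{a}_2\hat{a}_3\dots)_b$, where $\hat{a}_i$ is the string of base-$b$ digits of $a_i$ (without leading zeros), concatenated. $T_b$ is the set of Trott numbers in base $b$. -}

module Defs where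

open import Data.Nat using (ℕ; zero; suc; _+_; _*_; _^_; _<ᵇ_; _≤_)
open import Data.Bool using (if_then_else_)
open import Data.Product using (_×_; _,_; ∃)
open import Data.Integer using (+_)
open import Data.Rational.Unnormalised using (ℚᵘ; mkℚᵘ; 0ℚᵘ; _-_; _<_; ∣_∣)

-- Number of base-b digits of n (n ≥ 1, b ≥ 2): the least L ≥ 1 with n < b ^ L.
-- Search with fuel (n + 1 steps always suffice when b ≥ 2).
digitsGo : ℕ → ℕ → ℕ → ℕ → ℕ
digitsGo b n L zero       = L
digitsGo b n L (suc fuel) = if n <ᵇ b ^ L then L else digitsGo b n (suc L) fuel

numDigits : ℕ → ℕ → ℕ
numDigits b n = digitsGo b n 1 (suc n)

-- The rational p / d (d = 0 is never used; mapped to 0).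
frac : ℕ → ℕ → ℚᵘ
frac p zero    = 0ℚᵘ
frac p (suc d) = mkℚᵘ (+ p) d

-- Continued fraction [0; a 1, a 2, ...]; the value a 0 is ignored.
-- cfState a n = (p_n , q_n , p_{n-1} , q_{n-1}) with p_0 = 0, q_0 = 1, p_{-1} = 1, q_{-1} = 0.
cfState : (ℕ → ℕ) → ℕ → ℕ × ℕ × ℕ × ℕ
cfState a zero = 0 , 1 , 1 , 0
cfState a (suc n) with cfState a n
... | p , q , p' , q' = a (suc n) * p + p' , a (suc n) * q + q' , p , q

convergent : (ℕ → ℕ) → ℕ → ℚᵘ
convergent a n with cfState a n
... | p , q , _ , _ = frac p q

-- concatState b a n = (N , S): the base-b digit string â_1 â_2 ... â_n read as the
-- natural number N, having S digits in total.
concatState : ℕ → (ℕ → ℕ) → ℕ → ℕ × ℕ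
concatState b a zero = 0 , 0
concatState b a (suc n) with concatState b a n
... | N , S = N * b ^ numDigits b (a (suc n)) + a (suc n) , S + numDigits b (a (suc n))

concatValue : ℕ → (ℕ → ℕ) → ℕ → ℚᵘ
concatValue b a n with concatState b a n
... | N , S = frac N (b ^ S)

-- Since both sides are
-- limits of the rational sequences above (the digit string truncated after the block of
-- a n, resp. the n-th convergent), equality of the two reals is expressed as: the
-- difference of these sequences tends to 0.
IsTrott : ℕ → (ℕ → ℕ) → Set
IsTrott b a =
  (∀ i → 1 ≤ i → 1 ≤ a i) ×
  (∀ (ε : ℚᵘ) → 0ℚᵘ < ε → ∃ λ N → ∀ n → N ≤ n → ∣ concatValue b a n - convergent a n ∣ < ε)

{-# OPTIONS --safe #-}
module Submission where

-- Both the continued fraction and the digit expansion pin x down after two partial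
-- quotients: every later convergent lies between [0; a₁, a₂] and [0; a₁, a₂ + 1], and every
-- later truncation of the digit string lies in [N b⁻ˢ, (N + 1) b⁻ˢ], where N is the number
-- â₁â₂ and S its length. Comparing the two intervals gives a₁² < b^m for m the number of
-- digits of a₁, hence m = 1 and a₁ = k, as k² < b < (k + 1)². Writing b = k² + d and
-- P = bˡ, what remains says that the remainder r = dP − k a₂ satisfies
-- k² + d < d r ≤ k² + dk + d, i.e. that the ceiling equals a₂ + 1. The lower bound is a
-- cancellation (with d = k excluded by divisibility). For the upper bound, an excess
-- e = dr − (k² + dk + d) ≥ 1 is first shown to be at most 2k², and then
-- e d²P ≤ e (3k² + k² + dk + d) + k²(k² + dk + d) + d²k: this is impossible for d ≥ 2 as
-- P ≥ b², and for d = 1 because P ≡ 1 (mod k) forces k ∣ e while P > k³ + 5k² + 2k + 2,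
-- which is where l ≥ 3 is needed for b = 5.

open import Defs
open import Data.Nat using (ℕ; _+_; _*_; _^_; _∸_; _≤_)
open import Relation.Binary.PropositionalEquality using (_≡_; _≢_)
open import Data.Integer using (+_) renaming (_-_ to _-ℤ_)
open import Data.Rational.Unnormalised using (_-_; ceiling)

open import Data.Bool using (true; false; T)
open import Data.Empty using (⊥; ⊥-elim)
open import Data.Nat.Divisibility using (_∣_; ∣m+n∣m⇒∣n; ∣⇒≤; m∣m*n)
open import Data.List using (_∷_; [])
open import Data.Nat
  using (zero; suc; z≤n; s≤s; z<s; _<_; _<ᵇ_; _≤?_; _<?_; _≟_; NonZero; >-nonZero; _≤′_; ≤′-refl; ≤′-step)
open import Data.Nat.Properties
open import Data.Nat.Tactic.RingSolver using (solve)
open import Data.Product using (_×_; _,_; ∃; proj₁; proj₂)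
open import Data.Sum using (inj₁; inj₂)
open import Data.Unit using (tt)
open import Relation.Binary.PropositionalEquality
  using (refl; sym; trans; cong; cong₂; subst; subst₂; module ≡-Reasoning)
open import Relation.Nullary using (yes; no)
import Data.Integer as ℤ
import Data.Integer.Properties as ℤ
import Data.Integer.DivMod as ℤD
import Data.Rational.Unnormalised as ℚ
import Data.Rational.Unnormalised.Properties as ℚ

digitsGo-upper : ∀ b n L fuel → n < b ^ (L + fuel) → n < b ^ digitsGo b n L fuel
digitsGo-upper b n L zero n<b^L rewrite +-identityʳ L = n<b^L
digitsGo-upper b n L (suc fuel) n<b^L+fuel with n <ᵇ b ^ L in eq
... | true  = <ᵇ⇒< n (b ^ L) (subst T (sym eq) tt)
... | false = digitsGo-upper b n (suc L) fuel (subst (λ e → n < b ^ e) (+-suc L fuel) n<b^L+fuel)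

digitsGo-lower : ∀ b n L fuel → b ^ L ≤ b * n → b ^ digitsGo b n L fuel ≤ b * n
digitsGo-lower b n L zero b^L≤bn = b^L≤bn
digitsGo-lower b n L (suc fuel) b^L≤bn with n <ᵇ b ^ L in eq
... | true  = b^L≤bn
... | false = digitsGo-lower b n (suc L) fuel (*-monoʳ-≤ b (≮⇒≥ (λ n<b^L → subst T eq (<⇒<ᵇ n<b^L))))

digitsGo-pos : ∀ b n L fuel → 1 ≤ L → 1 ≤ digitsGo b n L fuel
digitsGo-pos b n L zero 1≤L = 1≤L
digitsGo-pos b n L (suc fuel) 1≤L with n <ᵇ b ^ L
... | true  = 1≤L
... | false = digitsGo-pos b n (suc L) fuel (s≤s z≤n)

n<b^n : ∀ {b} → 2 ≤ b → ∀ n → n < b ^ n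
n<b^n 2≤b zero    = s≤s z≤n
n<b^n {b} 2≤b (suc n) = begin
  suc (suc n)   ≤⟨ s≤s (n<b^n 2≤b n) ⟩
  suc (b ^ n)   ≤⟨ +-monoˡ-≤ (b ^ n) (m^n>0 b n) ⟩
  b ^ n + b ^ n ≡⟨ cong (_+_ (b ^ n)) (sym (+-identityʳ (b ^ n))) ⟩
  2 * b ^ n     ≤⟨ *-monoˡ-≤ (b ^ n) 2≤b ⟩
  b * b ^ n     ∎
  where
  open ≤-Reasoning
  instance _ = >-nonZero (≤-trans (s≤s z≤n) 2≤b)

numDigits-upper : ∀ {b} → 2 ≤ b → ∀ n → n < b ^ numDigits b n
numDigits-upper {b} 2≤b n = digitsGo-upper b n 1 (suc n)
  (<-≤-trans (n<b^n 2≤b n) (^-monoʳ-≤ b (m≤n+m n 2)))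
  where instance _ = >-nonZero (≤-trans (s≤s z≤n) 2≤b)

numDigits-lower : ∀ b n → 1 ≤ n → b ^ numDigits b n ≤ b * n
numDigits-lower b n 1≤n = digitsGo-lower b n 1 (suc n) (*-monoʳ-≤ b 1≤n)

numDigits-pos : ∀ b n → 1 ≤ numDigits b n
numDigits-pos b n = digitsGo-pos b n 1 (suc n) (s≤s z≤n)

frac-≤⁺ : ∀ {p q p′ q′} → 0 < q → 0 < q′ → p * q′ ≤ p′ * q → frac p q ℚ.≤ frac p′ q′
frac-≤⁺ {p} {suc q} {p′} {suc q′} _ _ pq′≤p′q =
  ℚ.*≤* (subst₂ ℤ._≤_ (ℤ.pos-* p (suc q′)) (ℤ.pos-* p′ (suc q)) (ℤ.+≤+ pq′≤p′q))

frac-≤⁻ : ∀ {p q p′ q′} → 0 < q → 0 < q′ → frac p q ℚ.≤ frac p′ q′ → p * q′ ≤ p′ * q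
frac-≤⁻ {p} {suc q} {p′} {suc q′} _ _ (ℚ.*≤* pq′≤p′q) =
  ℤ.drop‿+≤+ (subst₂ ℤ._≤_ (sym (ℤ.pos-* p (suc q′))) (sym (ℤ.pos-* p′ (suc q))) pq′≤p′q)

NullSequence : (ℕ → ℚ.ℚᵘ) → Set
NullSequence x = ∀ ε → ℚ.0ℚᵘ ℚ.< ε → ∃ λ N → ∀ n → N ≤ n → ℚ.∣ x n ∣ ℚ.< ε

NullSequence-sub-comm : ∀ (x y : ℕ → ℚ.ℚᵘ) → NullSequence (λ n → x n - y n) → NullSequence (λ n → y n - x n)
NullSequence-sub-comm x y null ε 0<ε with null ε 0<ε
... | N , small = N , λ n N≤n → subst (ℚ._< ε) (∣x-y∣≡∣y-x∣ n) (small n N≤n)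
  where
  ∣x-y∣≡∣y-x∣ : ∀ n → ℚ.∣ x n - y n ∣ ≡ ℚ.∣ y n - x n ∣
  ∣x-y∣≡∣y-x∣ n = begin
    ℚ.∣ x n - y n ∣          ≡⟨ sym (ℚ.∣-p∣≡∣p∣ (x n - y n)) ⟩
    ℚ.∣ ℚ.- (x n - y n) ∣    ≡⟨ cong ℚ.∣_∣ (ℚ.neg-distrib-+ (x n) (ℚ.- y n)) ⟩
    ℚ.∣ ℚ.- x n ℚ.+ ℚ.- ℚ.- y n ∣  ≡⟨ cong (λ z → ℚ.∣ ℚ.- x n ℚ.+ z ∣) (ℚ.neg-involutive-≡ (y n)) ⟩
    ℚ.∣ ℚ.- x n ℚ.+ y n ∣   ≡⟨ cong ℚ.∣_∣ (ℚ.+-comm-≡ (ℚ.- x n) (y n)) ⟩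
    ℚ.∣ y n - x n ∣          ∎
    where open ≡-Reasoning

≤-of-null-difference : ∀ {x y : ℕ → ℚ.ℚᵘ} {l u : ℚ.ℚᵘ} n₀ →
  (∀ n → n₀ ≤ n → l ℚ.≤ x n) → (∀ n → n₀ ≤ n → y n ℚ.≤ u) →
  NullSequence (λ n → x n - y n) → l ℚ.≤ u
≤-of-null-difference {x} {y} {l} {u} n₀ l≤x y≤u null with l ℚ.≤? u
... | yes l≤u = l≤u
... | no  l≰u = ⊥-elim (ℚ.<-irrefl-≡ refl (ℚ.≤-<-trans ε≤x-y x-y<ε))
  where
  ε : ℚ.ℚᵘ
  ε = l - u
  0<ε : ℚ.0ℚᵘ ℚ.< ε
  0<ε = ℚ.≤-<-trans (ℚ.≤-reflexive (ℚ.≃-sym (ℚ.+-inverseʳ u))) (ℚ.+-monoˡ-< (ℚ.- u) (ℚ.≰⇒> l≰u))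
  n = proj₁ (null ε 0<ε) + n₀
  ε≤x-y : ε ℚ.≤ x n - y n
  ε≤x-y = ℚ.+-mono-≤ (l≤x n (m≤n+m n₀ _)) (ℚ.neg-mono-≤ (y≤u n (m≤n+m n₀ _)))
  x-y<ε : x n - y n ℚ.< ε
  x-y<ε = subst (ℚ._< ε) (ℚ.0≤p⇒∣p∣≡p (ℚ.≤-trans (ℚ.<⇒≤ 0<ε) ε≤x-y))
                (proj₂ (null ε 0<ε) n (m≤m+n _ n₀))

cross-lower-append : ∀ N A B G → N * (B * G) ≤ (N * G + A) * B
cross-lower-append N A B G = begin
  N * (B * G)     ≡⟨ solve (N ∷ B ∷ G ∷ []) ⟩
  N * G * B       ≤⟨ *-monoˡ-≤ B (m≤m+n (N * G) A) ⟩
  (N * G + A) * B ∎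
  where open ≤-Reasoning

cross-upper-append : ∀ N A B G → A < G → (N * G + A + 1) * B ≤ (N + 1) * (B * G)
cross-upper-append N A B G A<G = begin
  (N * G + A + 1) * B   ≡⟨ solve (N ∷ A ∷ B ∷ G ∷ []) ⟩
  (N * G + (1 + A)) * B ≤⟨ *-monoˡ-≤ B (+-monoʳ-≤ (N * G) A<G) ⟩
  (N * G + G) * B       ≡⟨ solve (N ∷ B ∷ G ∷ []) ⟩
  (N + 1) * (B * G)     ∎
  where open ≤-Reasoning

digitString : ℕ → (ℕ → ℕ) → ℕ → ℕ
digitString b a n = proj₁ (concatState b a n)

digitLength : ℕ → (ℕ → ℕ) → ℕ → ℕ
digitLength b a n = proj₂ (concatState b a n)

module _ {b : ℕ} (2≤b : 2 ≤ b) (a : ℕ → ℕ) where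
  private
    N = digitString b a
    S = digitLength b a
    instance
      b-nonZero : NonZero b
      b-nonZero = >-nonZero (≤-trans (s≤s z≤n) 2≤b)
    b^>0 : ∀ e → 0 < b ^ e
    b^>0 = m^n>0 b

    lower-step : ∀ n → frac (N n) (b ^ S n) ℚ.≤ frac (N (suc n)) (b ^ S (suc n))
    lower-step n = frac-≤⁺ (b^>0 (S n)) (b^>0 (S (suc n)))
      (subst (λ e → N n * e ≤ N (suc n) * b ^ S n) (sym (^-distribˡ-+-* b (S n) g))
        (cross-lower-append (N n) A (b ^ S n) (b ^ g)))
      where
      A = a (suc n)
      g = numDigits b A

    upper-step : ∀ n → frac (N (suc n) + 1) (b ^ S (suc n)) ℚ.≤ frac (N n + 1) (b ^ S n)
    upper-step n = frac-≤⁺ (b^>0 (S (suc n))) (b^>0 (S n))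
      (subst (λ e → (N (suc n) + 1) * b ^ S n ≤ (N n + 1) * e) (sym (^-distribˡ-+-* b (S n) g))
        (cross-upper-append (N n) A (b ^ S n) (b ^ g) (numDigits-upper 2≤b A)))
      where
      A = a (suc n)
      g = numDigits b A

    upper-self : ∀ n → concatValue b a n ℚ.≤ frac (N n + 1) (b ^ S n)
    upper-self n = frac-≤⁺ (b^>0 (S n)) (b^>0 (S n)) (*-monoˡ-≤ (b ^ S n) (m≤m+n (N n) 1))

    upper-anti : ∀ {m n} → m ≤′ n → frac (N n + 1) (b ^ S n) ℚ.≤ frac (N m + 1) (b ^ S m)
    upper-anti ≤′-refl             = ℚ.≤-refl
    upper-anti (≤′-step {n} m≤n) = ℚ.≤-trans (upper-step n) (upper-anti m≤n)

  concatValue-lower : ∀ {m n} → m ≤′ n → frac (N m) (b ^ S m) ℚ.≤ concatValue b a n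
  concatValue-lower ≤′-refl             = ℚ.≤-refl
  concatValue-lower (≤′-step {n} m≤n) = ℚ.≤-trans (concatValue-lower m≤n) (lower-step n)

  concatValue-upper : ∀ {m n} → m ≤′ n → concatValue b a n ℚ.≤ frac (N m + 1) (b ^ S m)
  concatValue-upper {n = n} m≤n = ℚ.≤-trans (upper-self n) (upper-anti m≤n)

cfNum cfDen cfNum′ cfDen′ : (ℕ → ℕ) → ℕ → ℕ
cfNum  a n = proj₁ (cfState a n)
cfDen  a n = proj₁ (proj₂ (cfState a n))
cfNum′ a n = proj₁ (proj₂ (proj₂ (cfState a n)))
cfDen′ a n = proj₂ (proj₂ (proj₂ (cfState a n)))

cross-lower-weighted : ∀ x y u v → y * (u * (x * y + 1) + v * x) ≤ (u * y + v) * (x * y + 1)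
cross-lower-weighted x y u v = begin
  y * (u * (x * y + 1) + v * x)      ≡⟨ solve (x ∷ y ∷ u ∷ v ∷ []) ⟩
  y * (u * (x * y + 1) + v * x) + 0  ≤⟨ +-monoʳ-≤ _ z≤n ⟩
  y * (u * (x * y + 1) + v * x) + v  ≡⟨ solve (x ∷ y ∷ u ∷ v ∷ []) ⟩
  (u * y + v) * (x * y + 1)          ∎
  where open ≤-Reasoning

cross-upper-weighted : ∀ x y u v → v ≤ u →
  (u * y + v) * (x * (y + 1) + 1) ≤ (y + 1) * (u * (x * y + 1) + v * x)
cross-upper-weighted x y u v v≤u with m≤n⇒∃[o]m+o≡n v≤u
... | w , refl = begin
  ((v + w) * y + v) * (x * (y + 1) + 1)      ≤⟨ m≤m+n _ w ⟩
  ((v + w) * y + v) * (x * (y + 1) + 1) + w  ≡⟨ solve (x ∷ y ∷ v ∷ w ∷ []) ⟩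
  (y + 1) * ((v + w) * (x * y + 1) + v * x)  ∎
  where open ≤-Reasoning

*+-mono-≤ : ∀ {A u v u′ v′} → 1 ≤ A → v ≤ u → v + v′ ≤ u + u′ → A * v + v′ ≤ A * u + u′
*+-mono-≤ {A} {u} {v} {u′} {v′} 1≤A v≤u v+v′≤u+u′ with m≤n⇒∃[o]m+o≡n v≤u
... | w , refl = begin
  A * v + v′          ≤⟨ +-monoʳ-≤ (A * v) v′≤u′+w ⟩
  A * v + (u′ + w)    ≤⟨ +-monoʳ-≤ (A * v) (+-monoʳ-≤ u′ (m≤n*m w A)) ⟩
  A * v + (u′ + A * w) ≡⟨ solve (A ∷ v ∷ u′ ∷ w ∷ []) ⟩
  A * (v + w) + u′    ∎
  where
  open ≤-Reasoning
  instance _ = >-nonZero 1≤A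
  v′≤u′+w : v′ ≤ u′ + w
  v′≤u′+w = +-cancelˡ-≤ v v′ (u′ + w) 
    (subst (v + v′ ≤_) (trans (+-assoc v w u′) (cong (_+_ v) (+-comm w u′))) v+v′≤u+u′)

-- The convergent p_n / q_n is (u a₂ + v) / (u q₂ + v a₁), the mediant of [0; a₁, a₂] and
-- [0; a₁, a₂ + 1] with weights u − v and v; v ≤ u because the tail [a₃; …, a_n] is at least 1.
record ConvergentWeights (a : ℕ → ℕ) (n : ℕ) : Set where
  field
    u v u′ v′ : ℕ
    num≡  : cfNum  a n ≡ u  * a 2 + v
    den≡  : cfDen  a n ≡ u  * (a 1 * a 2 + 1) + v  * a 1
    num′≡ : cfNum′ a n ≡ u′ * a 2 + v′
    den′≡ : cfDen′ a n ≡ u′ * (a 1 * a 2 + 1) + v′ * a 1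
    1≤u   : 1 ≤ u
    v≤u   : v ≤ u
    v+v′≤u+u′ : v + v′ ≤ u + u′

module _ (a : ℕ → ℕ) (a-pos : ∀ i → 1 ≤ i → 1 ≤ a i) where
  open ConvergentWeights

  private
    weights₂ : ConvergentWeights a 2
    weights₂ = record
      { u = 1 ; v = 0 ; u′ = 0 ; v′ = 1
      ; num≡  = initial-num (a 1) (a 2)
      ; den≡  = initial-den (a 1) (a 2)
      ; num′≡ = initial-num′ (a 1) (a 2)
      ; den′≡ = initial-den′ (a 1) (a 2)
      ; 1≤u = s≤s z≤n ; v≤u = z≤n ; v+v′≤u+u′ = s≤s z≤n }
      where
      initial-num : ∀ x y → y * (x * 0 + 1) + 0 ≡ 1 * y + 0
      initial-num x y = solve (x ∷ y ∷ [])
      initial-num′ : ∀ x y → x * 0 + 1 ≡ 0 * y + 1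
      initial-num′ x y = solve (x ∷ y ∷ [])
      initial-den : ∀ x y → y * (x * 1 + 0) + 1 ≡ 1 * (x * y + 1) + 0 * x
      initial-den x y = solve (x ∷ y ∷ [])
      initial-den′ : ∀ x y → x * 1 + 0 ≡ 0 * (x * y + 1) + 1 * x
      initial-den′ x y = solve (x ∷ y ∷ [])

    weights-step : ∀ {n} → ConvergentWeights a n → ConvergentWeights a (suc n)
    weights-step {n} w = record
      { u = A * u w + u′ w ; v = A * v w + v′ w ; u′ = u w ; v′ = v w
      ; num≡  = trans (cong₂ (λ x y → A * x + y) (num≡ w) (num′≡ w))
                      (combine (a 2) A (u w) (v w) (u′ w) (v′ w))
      ; den≡  = trans (cong₂ (λ x y → A * x + y) (den≡ w) (den′≡ w))
                      (combine-den (a 1 * a 2 + 1) (a 1) A (u w) (v w) (u′ w) (v′ w))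
      ; num′≡ = num≡ w
      ; den′≡ = den≡ w
      ; 1≤u = ≤-trans (*-mono-≤ 1≤A (1≤u w)) (m≤m+n (A * u w) (u′ w))
      ; v≤u = Av+v′≤Au+u′
      ; v+v′≤u+u′ = +-mono-≤ Av+v′≤Au+u′ (v≤u w) }
      where
      A = a (suc n)
      1≤A : 1 ≤ A
      1≤A = a-pos (suc n) (s≤s z≤n)
      combine : ∀ y A u v u′ v′ → A * (u * y + v) + (u′ * y + v′) ≡ (A * u + u′) * y + (A * v + v′)
      combine y A u v u′ v′ = solve (y ∷ A ∷ u ∷ v ∷ u′ ∷ v′ ∷ [])
      combine-den : ∀ Q x A u v u′ v′ →
        A * (u * Q + v * x) + (u′ * Q + v′ * x) ≡ (A * u + u′) * Q + (A * v + v′) * x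
      combine-den Q x A u v u′ v′ = solve (Q ∷ x ∷ A ∷ u ∷ v ∷ u′ ∷ v′ ∷ [])
      Av+v′≤Au+u′ : A * v w + v′ w ≤ A * u w + u′ w
      Av+v′≤Au+u′ = *+-mono-≤ 1≤A (v≤u w) (v+v′≤u+u′ w)

    weights : ∀ {n} → 2 ≤′ n → ConvergentWeights a n
    weights ≤′-refl        = weights₂
    weights (≤′-step 2≤n) = weights-step (weights 2≤n)

    weightedDen-pos : ∀ {n} (w : ConvergentWeights a n) → 0 < u w * (a 1 * a 2 + 1) + v w * a 1
    weightedDen-pos w = ≤-trans (*-mono-≤ (1≤u w) (m≤n+m 1 (a 1 * a 2))) (m≤m+n _ (v w * a 1))

  convergent-lower : ∀ {n} → 2 ≤′ n → frac (a 2) (a 1 * a 2 + 1) ℚ.≤ convergent a n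
  convergent-lower 2≤n =
    subst₂ (λ p q → frac (a 2) (a 1 * a 2 + 1) ℚ.≤ frac p q) (sym (num≡ w)) (sym (den≡ w))
      (frac-≤⁺ (m≤n+m 1 (a 1 * a 2)) (weightedDen-pos w) (cross-lower-weighted (a 1) (a 2) (u w) (v w)))
    where w = weights 2≤n

  convergent-upper : ∀ {n} → 2 ≤′ n → convergent a n ℚ.≤ frac (a 2 + 1) (a 1 * (a 2 + 1) + 1)
  convergent-upper 2≤n =
    subst₂ (λ p q → frac p q ℚ.≤ frac (a 2 + 1) (a 1 * (a 2 + 1) + 1)) (sym (num≡ w)) (sym (den≡ w))
      (frac-≤⁺ (weightedDen-pos w) (m≤n+m 1 (a 1 * (a 2 + 1)))
        (cross-upper-weighted (a 1) (a 2) (u w) (v w) (v≤u w)))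
    where w = weights 2≤n

module _ {b : ℕ} (2≤b : 2 ≤ b) {a : ℕ → ℕ} (trott : IsTrott b a) where
  private
    a-pos : ∀ i → 1 ≤ i → 1 ≤ a i
    a-pos = proj₁ trott
    null : NullSequence (λ n → concatValue b a n - convergent a n)
    null = proj₂ trott
    P = b ^ numDigits b (a 2)
    B = b ^ numDigits b (a 1)
    instance
      b-nonZero : NonZero b
      b-nonZero = >-nonZero (≤-trans (s≤s z≤n) 2≤b)
    b^S≡BP : b ^ digitLength b a 2 ≡ B * P
    b^S≡BP = ^-distribˡ-+-* b (numDigits b (a 1)) (numDigits b (a 2))

  trott-upper : (a 1 * P + a 2) * (a 1 * (a 2 + 1) + 1) ≤ (a 2 + 1) * (B * P)
  trott-upper = subst (λ e → (a 1 * P + a 2) * (a 1 * (a 2 + 1) + 1) ≤ (a 2 + 1) * e) b^S≡BP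
   (frac-≤⁻ {digitString b a 2} {b ^ digitLength b a 2} {a 2 + 1} {a 1 * (a 2 + 1) + 1}
     (m^n>0 b (digitLength b a 2)) (m≤n+m 1 _)
    (≤-of-null-difference 2
      (λ n 2≤n → concatValue-lower 2≤b a (≤⇒≤′ 2≤n))
      (λ n 2≤n → convergent-upper a a-pos (≤⇒≤′ 2≤n))
      null))

  trott-lower : a 2 * (B * P) ≤ (a 1 * P + a 2 + 1) * (a 1 * a 2 + 1)
  trott-lower = subst (λ e → a 2 * e ≤ (a 1 * P + a 2 + 1) * (a 1 * a 2 + 1)) b^S≡BP
   (frac-≤⁻ {a 2} {a 1 * a 2 + 1} {digitString b a 2 + 1} {b ^ digitLength b a 2}
     (m≤n+m 1 _) (m^n>0 b (digitLength b a 2))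
    (≤-of-null-difference 2
      (λ n 2≤n → convergent-lower a a-pos (≤⇒≤′ 2≤n))
      (λ n 2≤n → concatValue-upper 2≤b a (≤⇒≤′ 2≤n))
      (NullSequence-sub-comm (concatValue b a) (convergent a) null)))

square<-of-upper : ∀ {x y P B} → 1 ≤ x → 1 ≤ P →
  (x * P + y) * (x * (y + 1) + 1) ≤ (y + 1) * (B * P) → x * x < B
square<-of-upper {x} {y} {P} {B} 1≤x 1≤P upper = *-cancelʳ-< ((y + 1) * P) (x * x) B (begin-strict
  x * x * ((y + 1) * P)                                   <⟨ m<m+n _ (≤-trans (*-mono-≤ 1≤x 1≤P) (m≤m+n (x * P) _)) ⟩
  x * x * ((y + 1) * P) + (x * P + y * (x * (y + 1) + 1)) ≡⟨ solve (x ∷ y ∷ P ∷ []) ⟩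
  (x * P + y) * (x * (y + 1) + 1)                         ≤⟨ upper ⟩
  (y + 1) * (B * P)                                       ≡⟨ solve (y ∷ B ∷ P ∷ []) ⟩
  B * ((y + 1) * P)                                       ∎)
  where open ≤-Reasoning

exponent≡1 : ∀ {b x m} → 2 ≤ b → 1 ≤ m → b ^ m ≤ b * x → x * x < b ^ m → m ≡ 1
exponent≡1 {m = 1} _ _ _ _ = refl
exponent≡1 {b} {x} {suc (suc m)} 2≤b _ b^m≤bx x²<b^m = ⊥-elim (<⇒≱ b^m<b (^-monoʳ-≤ b {1} {suc m} (s≤s z≤n)))
  where
  instance
    _ = >-nonZero (≤-trans (s≤s z≤n) 2≤b)
    _ = m^n≢0 b (suc m)
  b^m<b : b ^ suc m < b ^ 1
  b^m<b = *-cancelʳ-< (b ^ suc m) (b ^ suc m) (b ^ 1) (begin-strict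
    b ^ suc m * b ^ suc m  ≤⟨ *-mono-≤ (*-cancelˡ-≤ b b^m≤bx) (*-cancelˡ-≤ b b^m≤bx) ⟩
    x * x                  <⟨ x²<b^m ⟩
    b * b ^ suc m          ≡⟨ cong (_* b ^ suc m) (sym (*-identityʳ b)) ⟩
    b ^ 1 * b ^ suc m      ∎)
    where open ≤-Reasoning

≤-of-square< : ∀ {k b x} → b ≤ k * k + k → x * x < b → x ≤ k
≤-of-square< {k} {b} {x} b≤k²+k x²<b with x ≤? k
... | yes x≤k = x≤k
... | no  x≰k = ⊥-elim (<-irrefl refl (begin-strict
  suc k * suc k      ≤⟨ *-mono-≤ (≰⇒> x≰k) (≰⇒> x≰k) ⟩
  x * x              <⟨ x²<b ⟩
  b                  ≤⟨ b≤k²+k ⟩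
  k * k + k          <⟨ m<m+n (k * k + k) {suc k} z<s ⟩
  k * k + k + suc k  ≡⟨ solve (k ∷ []) ⟩
  suc k * suc k      ∎))
  where open ≤-Reasoning

cancel-denominator-lower : ∀ {b x y P} → y < P →
  y * (b * P) ≤ (x * P + y + 1) * (x * y + 1) → y * b ≤ (x + 1) * (x * y + 1)
cancel-denominator-lower {b} {x} {y} {P} y<P lower = *-cancelˡ-≤ P (begin
  P * (y * b)                    ≡⟨ solve (P ∷ y ∷ b ∷ []) ⟩
  y * (b * P)                    ≤⟨ lower ⟩
  (x * P + y + 1) * (x * y + 1)  ≤⟨ *-monoˡ-≤ (x * y + 1) xP+y+1≤xP+P ⟩
  (x * P + P) * (x * y + 1)      ≡⟨ solve (x ∷ y ∷ P ∷ []) ⟩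
  P * ((x + 1) * (x * y + 1))    ∎)
  where
  open ≤-Reasoning
  instance _ = >-nonZero (≤-trans (s≤s z≤n) y<P)
  xP+y+1≤xP+P : x * P + y + 1 ≤ x * P + P
  xP+y+1≤xP+P = ≤-trans (≤-reflexive (trans (+-assoc (x * P) y 1) (cong (_+_ (x * P)) (+-comm y 1))))
                        (+-monoʳ-≤ (x * P) y<P)

≥-of-lower : ∀ {k b x y P} → k * k + 1 ≤ b → 1 ≤ y → y < P →
  y * (b * P) ≤ (x * P + y + 1) * (x * y + 1) → k ≤ x
≥-of-lower {k} {b} {x} {y} {P} k²+1≤b 1≤y y<P lower with k ≤? x
... | yes k≤x = k≤x
... | no  k≰x with ≰⇒> k≰x | m≤n⇒∃[o]m+o≡n 1≤y
...   | s≤s {n = j} x≤j | y′ , refl = ⊥-elim (m+1+n≰m ((suc j) * (j * y + 1)) (begin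
  (suc j) * (j * y + 1) + suc (y′ * (j + 2)) ≡⟨ solve (j ∷ y′ ∷ []) ⟩
  y * (suc j * suc j + 1)                    ≤⟨ *-monoʳ-≤ y k²+1≤b ⟩
  y * b                                      ≤⟨ cancel-denominator-lower {x = x} y<P lower ⟩
  (x + 1) * (x * y + 1)                      ≤⟨ *-mono-≤ (+-monoˡ-≤ 1 x≤j) (+-monoˡ-≤ 1 (*-monoˡ-≤ y x≤j)) ⟩
  (j + 1) * (j * y + 1)                      ≡⟨ cong (_* (j * y + 1)) (+-comm j 1) ⟩
  (suc j) * (j * y + 1)                      ∎))
  where open ≤-Reasoning

kc<dP : ∀ {k d P c} → 1 ≤ k → 1 ≤ P →
  (k * P + c) * (k * (c + 1) + 1) ≤ (c + 1) * ((k * k + d) * P) → k * c < d * P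
kc<dP {k} {d} {P} {c} 1≤k 1≤P bound with k * c <? d * P
... | yes kc<dP = kc<dP
... | no  kc≮dP = ⊥-elim (<⇒≱ (m<m+n ((c + 1) * (k * k * P) + (c + 1) * (k * c)) 1≤kP+c) (begin
  (c + 1) * (k * k * P) + (c + 1) * (k * c) + (k * P + c)  ≡⟨ solve (k ∷ P ∷ c ∷ []) ⟩
  (k * P + c) * (k * (c + 1) + 1)                          ≤⟨ bound ⟩
  (c + 1) * ((k * k + d) * P)                              ≡⟨ solve (k ∷ d ∷ P ∷ c ∷ []) ⟩
  (c + 1) * (k * k * P) + (c + 1) * (d * P)                ≤⟨ +-monoʳ-≤ _ (*-monoʳ-≤ (c + 1) (≮⇒≥ kc≮dP)) ⟩
  (c + 1) * (k * k * P) + (c + 1) * (k * c)                ∎))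
  where
  open ≤-Reasoning
  1≤kP+c : 1 ≤ k * P + c
  1≤kP+c = ≤-trans (*-mono-≤ 1≤k 1≤P) (m≤m+n (k * P) c)

module _ {k d P c r : ℕ} (dP≡kc+r : d * P ≡ k * c + r) where
  open ≤-Reasoning

  remainder-lower : (k * P + c) * (k * (c + 1) + 1) ≤ (c + 1) * ((k * k + d) * P) → k * P + c ≤ r * (c + 1)
  remainder-lower bound = +-cancelˡ-≤ _ (k * P + c) (r * (c + 1)) (begin
    (c + 1) * (k * k * P) + (c + 1) * (k * c) + (k * P + c)  ≡⟨ solve (k ∷ P ∷ c ∷ []) ⟩
    (k * P + c) * (k * (c + 1) + 1)                          ≤⟨ bound ⟩
    (c + 1) * ((k * k + d) * P)                              ≡⟨ solve (k ∷ d ∷ P ∷ c ∷ []) ⟩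
    (c + 1) * (k * k * P) + (c + 1) * (d * P)                ≡⟨ cong (λ z → (c + 1) * (k * k * P) + (c + 1) * z) dP≡kc+r ⟩
    (c + 1) * (k * k * P) + (c + 1) * (k * c + r)            ≡⟨ solve (k ∷ P ∷ c ∷ r ∷ []) ⟩
    (c + 1) * (k * k * P) + (c + 1) * (k * c) + r * (c + 1)  ∎)

  remainder-upper : c * ((k * k + d) * P) ≤ (k * P + c + 1) * (k * c + 1) → r * c ≤ k * P + k * c + c + 1
  remainder-upper bound = +-cancelˡ-≤ _ (r * c) (k * P + k * c + c + 1) (begin
    c * (k * k * P) + k * c * c + r * c                    ≡⟨ solve (k ∷ P ∷ c ∷ r ∷ []) ⟩
    c * (k * k * P) + c * (k * c + r)                      ≡⟨ cong (λ z → c * (k * k * P) + c * z) (sym dP≡kc+r) ⟩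
    c * (k * k * P) + c * (d * P)                          ≡⟨ solve (k ∷ d ∷ P ∷ c ∷ []) ⟩
    c * ((k * k + d) * P)                                  ≤⟨ bound ⟩
    (k * P + c + 1) * (k * c + 1)                          ≡⟨ solve (k ∷ P ∷ c ∷ []) ⟩
    c * (k * k * P) + k * c * c + (k * P + k * c + c + 1)  ∎)

  k≤d-of-small-remainder : 1 ≤ r → k * P + c ≤ r * (c + 1) → d * r ≤ k * k + d → k ≤ d
  k≤d-of-small-remainder 1≤r lower small = *-cancelʳ-≤ k d r {{>-nonZero 1≤r}}
    (+-cancelˡ-≤ (k * k * c + d * c) (k * r) (d * r) (begin
      k * k * c + d * c + k * r      ≡⟨ solve (k ∷ d ∷ c ∷ r ∷ []) ⟩
      k * (k * c + r) + d * c        ≡⟨ cong (λ z → k * z + d * c) (sym dP≡kc+r) ⟩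
      k * (d * P) + d * c            ≡⟨ solve (k ∷ d ∷ P ∷ c ∷ []) ⟩
      d * (k * P + c)                ≤⟨ *-monoʳ-≤ d lower ⟩
      d * (r * (c + 1))              ≡⟨ solve (d ∷ c ∷ r ∷ []) ⟩
      d * r * c + d * r              ≤⟨ +-monoˡ-≤ (d * r) (*-monoˡ-≤ c small) ⟩
      (k * k + d) * c + d * r        ≡⟨ solve (k ∷ d ∷ c ∷ r ∷ []) ⟩
      k * k * c + d * c + d * r      ∎))

small-remainder-absurd-d≡k : ∀ {k P c r} → 2 ≤ k → 1 ≤ c → k * P ≡ k * c + r →
  k * P + c ≤ r * (c + 1) → k * r ≤ k * k + k → ⊥
small-remainder-absurd-d≡k {k} {P} {c} {r} 2≤k 1≤c kP≡kc+r lower small = <⇒≱ 2≤k (∣⇒≤ k∣1)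
  where
  instance
    _ = >-nonZero (≤-trans (s≤s z≤n) 2≤k)
    _ = >-nonZero 1≤c
  k+1≤r : k + 1 ≤ r
  k+1≤r = *-cancelʳ-≤ (k + 1) r c (begin
    (k + 1) * c    ≡⟨ solve (k ∷ c ∷ []) ⟩
    k * c + c      ≤⟨ +-cancelʳ-≤ r (k * c + c) (r * c) (begin
      k * c + c + r  ≡⟨ solve (k ∷ c ∷ r ∷ []) ⟩
      k * c + r + c  ≡⟨ cong (_+ c) (sym kP≡kc+r) ⟩
      k * P + c      ≤⟨ lower ⟩
      r * (c + 1)    ≡⟨ solve (c ∷ r ∷ []) ⟩
      r * c + r      ∎) ⟩
    r * c          ∎)
    where open ≤-Reasoning
  r≤k+1 : r ≤ k + 1
  r≤k+1 = *-cancelˡ-≤ k (≤-trans small (≤-reflexive (solve (k ∷ []))))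
  k∣1 : k ∣ 1
  k∣1 = ∣m+n∣m⇒∣n (subst (k ∣_) kP≡k[c+1]+1 (m∣m*n P)) (m∣m*n (c + 1))
    where
    kP≡k[c+1]+1 : k * P ≡ k * (c + 1) + 1
    kP≡k[c+1]+1 = trans kP≡kc+r (trans (cong (_+_ (k * c)) (≤-antisym r≤k+1 k+1≤r)) (solve (k ∷ c ∷ [])))

k*k+d<dr : ∀ {k d P c r} → 2 ≤ k → d ≤ k → 1 ≤ c → 1 ≤ r → d * P ≡ k * c + r →
  k * P + c ≤ r * (c + 1) → k * k + d < d * r
k*k+d<dr {k} {d} {P} {c} {r} 2≤k d≤k 1≤c 1≤r dP≡kc+r lower with k * k + d <? d * r
... | yes b<dr = b<dr
... | no  b≮dr with ≤-antisym d≤k (k≤d-of-small-remainder dP≡kc+r 1≤r lower (≮⇒≥ b≮dr))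
...   | refl = ⊥-elim (small-remainder-absurd-d≡k 2≤k 1≤c dP≡kc+r lower (≮⇒≥ b≮dr))

excess-bound : ∀ {k d P c r e} → d * P ≡ k * c + r → d * r ≡ (k * k + d * k + d) + e →
  r * c ≤ k * P + k * c + c + 1 → c * e ≤ k * r + d
excess-bound {k} {d} {P} {c} {r} {e} dP≡kc+r dr≡C+e upper =
  +-cancelˡ-≤ (k * k * c + d * k * c + d * c) (c * e) (k * r + d) (begin
    k * k * c + d * k * c + d * c + c * e      ≡⟨ solve (k ∷ d ∷ c ∷ e ∷ []) ⟩
    c * ((k * k + d * k + d) + e)              ≡⟨ cong (_*_ c) (sym dr≡C+e) ⟩
    c * (d * r)                                ≡⟨ solve (d ∷ c ∷ r ∷ []) ⟩
    d * (r * c)                                ≤⟨ *-monoʳ-≤ d upper ⟩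
    d * (k * P + k * c + c + 1)                ≡⟨ solve (k ∷ d ∷ P ∷ c ∷ []) ⟩
    k * (d * P) + d * k * c + d * c + d        ≡⟨ cong (λ z → k * z + d * k * c + d * c + d) dP≡kc+r ⟩
    k * (k * c + r) + d * k * c + d * c + d    ≡⟨ solve (k ∷ d ∷ c ∷ r ∷ []) ⟩
    k * k * c + d * k * c + d * c + (k * r + d) ∎)
  where open ≤-Reasoning

excess≤2k² : ∀ {k e} → 2 ≤ k → (k * k + 1) * e ≤ k * e + (k * (k * k + k * k + k) + k * k) → e ≤ 2 * k * k
excess≤2k² {k} {e} 2≤k bound with e ≤? 2 * k * k
... | yes e≤2k² = e≤2k²
... | no  e≰2k² with m≤n⇒∃[o]m+o≡n 2≤k | m≤n⇒∃[o]m+o≡n (≰⇒> e≰2k²)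
...   | j , refl | f , refl = ⊥-elim (m+1+n≰m _ (≤-trans (≤-reflexive gap) bound))
  where
  gap : k * e + (k * (k * k + k * k + k) + k * k)
          + suc ((3 + 3 * j + j * j) * f + (2 + 19 * j + 25 * j * j + 12 * j * j * j + 2 * j * j * j * j))
        ≡ (k * k + 1) * e
  gap = solve (j ∷ f ∷ [])

excess-linear-bound : ∀ {k d P c r e} → 1 ≤ d → d ≤ k →
  (k * k + d) * (k * k + d) ≤ P → P ≤ (k * k + d) * c →
  d * r ≡ (k * k + d * k + d) + e → c * e ≤ k * r + d →
  (k * k + 1) * e ≤ k * e + (k * (k * k + k * k + k) + k * k)
excess-linear-bound {k} {d} {P} {c} {r} {e} 1≤d d≤k b²≤P P≤bc dr≡C+e ce≤kr+d = begin
  (k * k + 1) * e                          ≤⟨ *-monoˡ-≤ e (+-monoʳ-≤ (k * k) 1≤d) ⟩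
  (k * k + d) * e                          ≤⟨ be≤kC+ke+d² ⟩
  k * (k * k + d * k + d) + k * e + d * d  ≤⟨ +-mono-≤ (+-monoˡ-≤ (k * e) (*-monoʳ-≤ k C≤2k²+k)) (*-mono-≤ d≤k d≤k) ⟩
  k * (k * k + k * k + k) + k * e + k * k  ≡⟨ solve (k ∷ e ∷ []) ⟩
  k * e + (k * (k * k + k * k + k) + k * k) ∎
  where
  open ≤-Reasoning
  instance
    _ = >-nonZero 1≤d
    _ = >-nonZero (≤-trans 1≤d (m≤n+m d (k * k)))
  C≤2k²+k : k * k + d * k + d ≤ k * k + k * k + k
  C≤2k²+k = +-mono-≤ (+-monoʳ-≤ (k * k) (*-monoˡ-≤ k d≤k)) d≤k
  Pe≤b[kr+d] : P * e ≤ (k * k + d) * (k * r + d)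
  Pe≤b[kr+d] = begin
    P * e                    ≤⟨ *-monoˡ-≤ e P≤bc ⟩
    (k * k + d) * c * e      ≡⟨ *-assoc (k * k + d) c e ⟩
    (k * k + d) * (c * e)    ≤⟨ *-monoʳ-≤ (k * k + d) ce≤kr+d ⟩
    (k * k + d) * (k * r + d) ∎
  be≤kC+ke+d² : (k * k + d) * e ≤ k * (k * k + d * k + d) + k * e + d * d
  be≤kC+ke+d² = *-cancelˡ-≤ (k * k + d) (begin
    (k * k + d) * ((k * k + d) * e)          ≡⟨ sym (*-assoc (k * k + d) (k * k + d) e) ⟩
    (k * k + d) * (k * k + d) * e            ≤⟨ *-monoˡ-≤ e b²≤P ⟩
    P * e                                    ≤⟨ m≤n*m (P * e) d ⟩
    d * (P * e)                              ≤⟨ *-monoʳ-≤ d Pe≤b[kr+d] ⟩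
    d * ((k * k + d) * (k * r + d))          ≡⟨ solve (k ∷ d ∷ r ∷ []) ⟩
    (k * k + d) * (k * (d * r) + d * d)      ≡⟨ cong (λ z → (k * k + d) * (k * z + d * d)) dr≡C+e ⟩
    (k * k + d) * (k * ((k * k + d * k + d) + e) + d * d) ≡⟨ solve (k ∷ d ∷ e ∷ []) ⟩
    (k * k + d) * (k * (k * k + d * k + d) + k * e + d * d) ∎)

excess-bound-weighted : ∀ {k d P c r e C} → d * P ≡ k * c + r → d * r ≡ C + e →
  c * e ≤ k * r + d → e ≤ 2 * k * k →
  e * (d * d * P) ≤ e * (3 * k * k + C) + (k * k * C + d * d * k)
excess-bound-weighted {k} {d} {P} {c} {r} {e} {C} dP≡kc+r dr≡C+e ce≤kr+d e≤2k² = begin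
  e * (d * d * P)                            ≡⟨ solve (d ∷ P ∷ e ∷ []) ⟩
  e * (d * (d * P))                          ≡⟨ cong (λ z → e * (d * z)) dP≡kc+r ⟩
  e * (d * (k * c + r))                      ≡⟨ solve (k ∷ d ∷ c ∷ r ∷ e ∷ []) ⟩
  d * k * (c * e) + e * (d * r)              ≤⟨ +-monoˡ-≤ (e * (d * r)) (*-monoʳ-≤ (d * k) ce≤kr+d) ⟩
  d * k * (k * r + d) + e * (d * r)          ≡⟨ solve (k ∷ d ∷ r ∷ e ∷ []) ⟩
  k * k * (d * r) + d * d * k + e * (d * r)  ≡⟨ cong (λ z → k * k * z + d * d * k + e * z) dr≡C+e ⟩
  k * k * (C + e) + d * d * k + e * (C + e)  ≡⟨ solve (k ∷ d ∷ e ∷ C ∷ []) ⟩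
  e * (k * k + C) + e * e + (k * k * C + d * d * k)
    ≤⟨ +-monoˡ-≤ (k * k * C + d * d * k) (+-monoʳ-≤ (e * (k * k + C)) (*-monoʳ-≤ e e≤2k²)) ⟩
  e * (k * k + C) + e * (2 * k * k) + (k * k * C + d * d * k) ≡⟨ solve (k ∷ d ∷ e ∷ C ∷ []) ⟩
  e * (3 * k * k + C) + (k * k * C + d * d * k) ∎
  where open ≤-Reasoning

affine-< : ∀ {e t X Y Z K} → t ≤ e → Y + Z ≤ X → K < t * Z → e * Y + K < e * X
affine-< {e} {t} {X} {Y} {Z} {K} t≤e Y+Z≤X K<tZ = begin-strict
  e * Y + K      <⟨ +-monoʳ-< (e * Y) K<tZ ⟩
  e * Y + t * Z  ≤⟨ +-monoʳ-≤ (e * Y) (*-monoˡ-≤ Z t≤e) ⟩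
  e * Y + e * Z  ≡⟨ sym (*-distribˡ-+ e Y Z) ⟩
  e * (Y + Z)    ≤⟨ *-monoʳ-≤ e Y+Z≤X ⟩
  e * X          ∎
  where open ≤-Reasoning

excess-absurd-2≤d : ∀ {k d P e} → 2 ≤ d → d ≤ k → (k * k + d) * (k * k + d) ≤ P → 1 ≤ e →
  e * (d * d * P) ≤ e * (3 * k * k + (k * k + d * k + d)) + (k * k * (k * k + d * k + d) + d * d * k) → ⊥
excess-absurd-2≤d {k} {d} {P} {e} 2≤d d≤k b²≤P 1≤e bound =
  <⇒≱ (affine-< 1≤e Y+K+1≤d²P (≤-reflexive (trans (+-comm 1 K) (sym (*-identityˡ (K + 1)))))) bound
  where
  open ≤-Reasoning
  C = k * k + d * k + d
  K = k * k * C + d * d * k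
  C≤2k²+k : C ≤ k * k + k * k + k
  C≤2k²+k = +-mono-≤ (+-monoʳ-≤ (k * k) (*-monoˡ-≤ k d≤k)) d≤k
  quartic : ∀ k → 1 ≤ k →
    (3 * k * k + (k * k + k * k + k)) + (k * k * (k * k + k * k + k) + k * k * k + 1) ≤ 4 * ((k * k + 2) * (k * k + 2))
  quartic k 1≤k with m≤n⇒∃[o]m+o≡n 1≤k
  ... | j , refl = ≤-trans (m≤m+n _ (25 + 23 * j + 17 * j * j + 6 * j * j * j + 2 * j * j * j * j))
                           (≤-reflexive (solve (j ∷ [])))
  Y+K+1≤d²P : (3 * k * k + C) + (K + 1) ≤ d * d * P
  Y+K+1≤d²P = begin
    (3 * k * k + C) + (K + 1)
      ≤⟨ +-mono-≤ (+-monoʳ-≤ (3 * k * k) C≤2k²+k)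
                  (+-monoˡ-≤ 1 (+-mono-≤ (*-monoʳ-≤ (k * k) C≤2k²+k) (*-monoˡ-≤ k (*-mono-≤ d≤k d≤k)))) ⟩
    (3 * k * k + (k * k + k * k + k)) + (k * k * (k * k + k * k + k) + k * k * k + 1)
      ≤⟨ quartic k (≤-trans (s≤s z≤n) (≤-trans 2≤d d≤k)) ⟩
    4 * ((k * k + 2) * (k * k + 2))
      ≤⟨ *-mono-≤ (*-mono-≤ 2≤d 2≤d) (*-mono-≤ (+-monoʳ-≤ (k * k) 2≤d) (+-monoʳ-≤ (k * k) 2≤d)) ⟩
    d * d * ((k * k + d) * (k * k + d))
      ≤⟨ *-monoʳ-≤ (d * d) b²≤P ⟩
    d * d * P ∎

excess-absurd-d≡1 : ∀ {k d P c r e m} → 1 ≤ k → d ≡ 1 → P ≡ 1 + k * m → k * k * k + 5 * k * k + 2 * k + 2 < P →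
  d * P ≡ k * c + r → d * r ≡ (k * k + d * k + d) + e → 1 ≤ e →
  e * (d * d * P) ≤ e * (3 * k * k + (k * k + d * k + d)) + (k * k * (k * k + d * k + d) + d * d * k) → ⊥
excess-absurd-d≡1 {k} {.1} {P} {c} {r} {e} {m} 1≤k refl P≡1+km P-large P≡kc+r r≡C+e 1≤e bound =
  <⇒≱ (affine-< k≤e Y+Z≤P K<kZ) bound
  where
  open ≤-Reasoning
  instance _ = >-nonZero 1≤e
  km≡k[c+k+1]+e : k * m ≡ k * (c + k + 1) + e
  km≡k[c+k+1]+e = +-cancelˡ-≡ 1 (k * m) (k * (c + k + 1) + e) (begin-equality
    1 + k * m                           ≡⟨ sym P≡1+km ⟩
    P                                   ≡⟨ solve (P ∷ []) ⟩
    1 * P                               ≡⟨ P≡kc+r ⟩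
    k * c + r                           ≡⟨ cong (_+_ (k * c)) (trans (sym (*-identityˡ r)) r≡C+e) ⟩
    k * c + ((k * k + 1 * k + 1) + e)   ≡⟨ solve (k ∷ c ∷ e ∷ []) ⟩
    1 + (k * (c + k + 1) + e)           ∎)
  k≤e : k ≤ e
  k≤e = ∣⇒≤ (∣m+n∣m⇒∣n (subst (k ∣_) km≡k[c+k+1]+e (m∣m*n m)) (m∣m*n (c + k + 1)))
  Y+Z≤P : 3 * k * k + (k * k + 1 * k + 1) + (k * k * k + k * k + k + 2) ≤ 1 * 1 * P
  Y+Z≤P = begin
    3 * k * k + (k * k + 1 * k + 1) + (k * k * k + k * k + k + 2) ≡⟨ solve (k ∷ []) ⟩
    suc (k * k * k + 5 * k * k + 2 * k + 2) ≤⟨ P-large ⟩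
    P                                       ≡⟨ solve (P ∷ []) ⟩
    1 * 1 * P                               ∎
  K<kZ : k * k * (k * k + 1 * k + 1) + 1 * 1 * k < k * (k * k * k + k * k + k + 2)
  K<kZ = begin-strict
    k * k * (k * k + 1 * k + 1) + 1 * 1 * k      <⟨ m<m+n _ 1≤k ⟩
    k * k * (k * k + 1 * k + 1) + 1 * 1 * k + k  ≡⟨ solve (k ∷ []) ⟩
    k * (k * k * k + k * k + k + 2)              ∎

excess-absurd : ∀ {k d P c r e} → 2 ≤ k → 1 ≤ d → d ≤ k → (k * k + d) * (k * k + d) ≤ P →
  (d ≡ 1 → ∃ λ m → P ≡ 1 + k * m) → (d ≡ 1 → k * k * k + 5 * k * k + 2 * k + 2 < P) →
  d * P ≡ k * c + r → d * r ≡ (k * k + d * k + d) + e → 1 ≤ e →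
  e * (d * d * P) ≤ e * (3 * k * k + (k * k + d * k + d)) + (k * k * (k * k + d * k + d) + d * d * k) → ⊥
excess-absurd 2≤k 1≤d d≤k b²≤P P≡1[k] P-large dP≡kc+r dr≡C+e 1≤e bound with m≤n⇒m<n∨m≡n 1≤d
... | inj₁ 2≤d = excess-absurd-2≤d 2≤d d≤k b²≤P 1≤e bound
... | inj₂ 1≡d = excess-absurd-d≡1 (≤-trans (s≤s z≤n) 2≤k) (sym 1≡d)
                   (proj₂ (P≡1[k] (sym 1≡d))) (P-large (sym 1≡d)) dP≡kc+r dr≡C+e 1≤e bound

d*r≤k*k+d*k+d : ∀ {k d P c r} → 2 ≤ k → 1 ≤ d → d ≤ k →
  (k * k + d) * (k * k + d) ≤ P → P ≤ (k * k + d) * c →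
  (d ≡ 1 → ∃ λ m → P ≡ 1 + k * m) → (d ≡ 1 → k * k * k + 5 * k * k + 2 * k + 2 < P) →
  d * P ≡ k * c + r → r * c ≤ k * P + k * c + c + 1 → d * r ≤ k * k + d * k + d
d*r≤k*k+d*k+d {k} {d} {P} {c} {r} 2≤k 1≤d d≤k b²≤P P≤bc P≡1[k] P-large dP≡kc+r upper
  with d * r ≤? k * k + d * k + d
... | yes dr≤C = dr≤C
... | no  dr≰C with m≤n⇒∃[o]m+o≡n (≰⇒> dr≰C)
...   | o , C+1+o≡dr =
  ⊥-elim (excess-absurd 2≤k 1≤d d≤k b²≤P P≡1[k] P-large dP≡kc+r dr≡C+e (s≤s z≤n) weighted)
  where
  dr≡C+e : d * r ≡ (k * k + d * k + d) + suc o
  dr≡C+e = trans (sym C+1+o≡dr) (sym (+-suc (k * k + d * k + d) o))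
  ce≤kr+d : c * suc o ≤ k * r + d
  ce≤kr+d = excess-bound {k} {d} {P} {c} {r} dP≡kc+r dr≡C+e upper
  weighted : suc o * (d * d * P) ≤ suc o * (3 * k * k + (k * k + d * k + d)) + (k * k * (k * k + d * k + d) + d * d * k)
  weighted = excess-bound-weighted {k} {d} {P} {c} {r} dP≡kc+r dr≡C+e ce≤kr+d
               (excess≤2k² 2≤k (excess-linear-bound {k} {d} {P} {c} {r} 1≤d d≤k b²≤P P≤bc dr≡C+e ce≤kr+d))

/-unique : ∀ x D .{{_ : NonZero D}} q → q ℤ.* + D ℤ.≤ x → x ℤ.< ℤ.suc q ℤ.* + D → x ℤ./ + D ≡ q
/-unique x D q qD≤x x<[q+1]D = ℤ.≤-antisym (≤q x<[q+1]D') (≤q (ℤ.≤-<-trans qD≤x x<[x/D+1]D))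
  where
  ≤q : ∀ {p q} → p ℤ.* + D ℤ.< ℤ.suc q ℤ.* + D → p ℤ.≤ q
  ≤q {p} {q} pD<[q+1]D = subst (p ℤ.≤_) (ℤ.pred-suc q)
    (ℤ.i<j⇒i≤pred[j] {p} {ℤ.suc q} (ℤ.*-cancelʳ-<-nonNeg {p} {ℤ.suc q} (+ D) pD<[q+1]D))
  x<[x/D+1]D : x ℤ.< ℤ.suc (x ℤ./ + D) ℤ.* + D
  x<[x/D+1]D = subst (λ z → x ℤ.< ℤ.suc z ℤ.* + D) (sym (ℤD.div-pos-is-/ℕ x D)) (ℤD.n<s[n/ℕd]*d x D)
  x<[q+1]D' : (x ℤ./ + D) ℤ.* + D ℤ.< ℤ.suc q ℤ.* + D
  x<[q+1]D' = ℤ.≤-<-trans (ℤD.[n/d]*d≤n x (+ D)) x<[q+1]D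

scale-by-k : ∀ {k d X B c} → 1 ≤ k →
  k * d * c + B < X * d → X * d ≤ k * d * c + k * d + B →
  B * k + c * (k * (k * d)) < X * (k * d) × X * (k * d) ≤ B * k + suc c * (k * (k * d))
scale-by-k {k} {d} {X} {B} {c} 1≤k lower upper = lower′ , upper′
  where
  open ≤-Reasoning
  instance _ = >-nonZero 1≤k
  lower′ : B * k + c * (k * (k * d)) < X * (k * d)
  lower′ = begin-strict
    B * k + c * (k * (k * d))  ≡⟨ solve (k ∷ d ∷ B ∷ c ∷ []) ⟩
    k * (k * d * c + B)        <⟨ *-monoʳ-< k lower ⟩
    k * (X * d)                ≡⟨ solve (k ∷ d ∷ X ∷ []) ⟩
    X * (k * d)                ∎
  upper′ : X * (k * d) ≤ B * k + suc c * (k * (k * d))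
  upper′ = begin
    X * (k * d)                  ≡⟨ solve (k ∷ d ∷ X ∷ []) ⟩
    k * (X * d)                  ≤⟨ *-monoʳ-≤ k upper ⟩
    k * (k * d * c + k * d + B)  ≡⟨ solve (k ∷ d ∷ B ∷ c ∷ []) ⟩
    B * k + suc c * (k * (k * d)) ∎

ceiling-frac-sub : ∀ {k d X B c} → 1 ≤ k → 1 ≤ d →
  k * d * c + B < X * d → X * d ≤ k * d * c + k * d + B →
  ceiling (frac X k - frac B (k * d)) ≡ + suc c
ceiling-frac-sub {suc k₀} {suc d₀} {X} {B} {c} 1≤k _ lower upper =
  trans (cong (λ z → ℤ.- (ℤ.- z ℤ./ + D)) y≡n) (cong ℤ.-_ (/-unique (ℤ.- + n) D ℤ.-[1+ c ] [-1-c]D≤-n -n<[-c]D))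
  where
  -- y / D is frac X k - frac B (k * d) as computed by ℚᵘ, whose ceiling is - ((- y) / D).
  k = suc k₀
  d = suc d₀
  M = k * d
  D = k * M
  y : ℤ.ℤ
  y = + X ℤ.* + M ℤ.+ (ℤ.- + B) ℤ.* + k
  Bk+cD<XM : B * k + c * D < X * M
  Bk+cD<XM = proj₁ (scale-by-k {k} {d} {X} {B} {c} 1≤k lower upper)
  XM≤Bk+[c+1]D : X * M ≤ B * k + suc c * D
  XM≤Bk+[c+1]D = proj₂ (scale-by-k {k} {d} {X} {B} {c} 1≤k lower upper)
  excess : ∃ λ n → B * k + n ≡ X * M
  excess = m≤n⇒∃[o]m+o≡n (≤-trans (m≤m+n (B * k) (c * D)) (<⇒≤ Bk+cD<XM))
  n = proj₁ excess
  Bk+n≡XM : B * k + n ≡ X * M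
  Bk+n≡XM = proj₂ excess
  neg-pos-* : ∀ i j → ℤ.- + (i * j) ≡ ℤ.- + i ℤ.* + j
  neg-pos-* i j = trans (cong ℤ.-_ (ℤ.pos-* i j)) (ℤ.neg-distribˡ-* (+ i) (+ j))
  y≡n : y ≡ + n
  y≡n = begin
    + X ℤ.* + M ℤ.+ (ℤ.- + B) ℤ.* + k    ≡⟨ cong₂ ℤ._+_ (sym (ℤ.pos-* X M)) (sym (neg-pos-* B k)) ⟩
    + (X * M) ℤ.+ ℤ.- + (B * k)         ≡⟨ ℤ.m-n≡m⊖n (X * M) (B * k) ⟩
    (X * M) ℤ.⊖ (B * k)                 ≡⟨ cong (ℤ._⊖ (B * k)) (sym Bk+n≡XM) ⟩
    (B * k + n) ℤ.⊖ (B * k)             ≡⟨ ℤ.⊖-≥ (m≤m+n (B * k) n) ⟩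
    + (B * k + n ∸ B * k)               ≡⟨ cong +_ (m+n∸m≡n (B * k) n) ⟩
    + n                                 ∎
    where open ≡-Reasoning
  n≤[c+1]D : n ≤ suc c * D
  n≤[c+1]D = +-cancelˡ-≤ (B * k) n (suc c * D) (subst (_≤ B * k + suc c * D) (sym Bk+n≡XM) XM≤Bk+[c+1]D)
  cD<n : c * D < n
  cD<n = +-cancelˡ-< (B * k) (c * D) n (subst (B * k + c * D <_) (sym Bk+n≡XM) Bk+cD<XM)
  suc-[1+c] : ∀ c → ℤ.- + c ≡ ℤ.suc ℤ.-[1+ c ]
  suc-[1+c] zero    = refl
  suc-[1+c] (suc c) = refl
  [-1-c]D≤-n : ℤ.-[1+ c ] ℤ.* + D ℤ.≤ ℤ.- + n
  [-1-c]D≤-n = subst (ℤ._≤ ℤ.- + n) (neg-pos-* (suc c) D) (ℤ.neg-mono-≤ (ℤ.+≤+ n≤[c+1]D))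
  -n<[-c]D : ℤ.- + n ℤ.< ℤ.suc ℤ.-[1+ c ] ℤ.* + D
  -n<[-c]D = subst (ℤ.- + n ℤ.<_) (trans (neg-pos-* c D) (cong (ℤ._* + D) (suc-[1+c] c))) (ℤ.neg-mono-< (ℤ.+<+ cD<n))

first-quotient : ∀ {k b a} → 2 ≤ k → k * k + 1 ≤ b → b ≤ k * k + k → IsTrott b a →
  a 1 ≡ k × b ^ numDigits b (a 1) ≡ b
first-quotient {k} {b} {a} 2≤k k²+1≤b b≤k²+k trott@(a-pos , _) = a₁≡k , B≡b
  where
  2≤b : 2 ≤ b
  2≤b = ≤-trans (s≤s (s≤s z≤n)) (≤-trans (+-monoˡ-≤ 1 (*-mono-≤ 2≤k 2≤k)) k²+1≤b)
  instance _ = >-nonZero (≤-trans (s≤s z≤n) 2≤b)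
  P = b ^ numDigits b (a 2)
  1≤a₁ : 1 ≤ a 1
  1≤a₁ = a-pos 1 (s≤s z≤n)
  a₁²<B : a 1 * a 1 < b ^ numDigits b (a 1)
  a₁²<B = square<-of-upper 1≤a₁ (m^n>0 b (numDigits b (a 2))) (trott-upper 2≤b trott)
  B≡b : b ^ numDigits b (a 1) ≡ b
  B≡b = trans (cong (b ^_) (exponent≡1 2≤b (numDigits-pos b (a 1)) (numDigits-lower b (a 1) 1≤a₁) a₁²<B))
              (*-identityʳ b)
  a₁≤k : a 1 ≤ k
  a₁≤k = ≤-of-square< b≤k²+k (subst (a 1 * a 1 <_) B≡b a₁²<B)
  k≤a₁ : k ≤ a 1
  k≤a₁ = ≥-of-lower k²+1≤b (a-pos 2 (s≤s z≤n)) (numDigits-upper 2≤b (a 2))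
           (subst (λ B → a 2 * (B * P) ≤ (a 1 * P + a 2 + 1) * (a 1 * a 2 + 1)) B≡b (trott-lower 2≤b trott))
  a₁≡k : a 1 ≡ k
  a₁≡k = ≤-antisym a₁≤k k≤a₁

[k*k+1]^n≡1+k*m : ∀ k n → ∃ λ m → (k * k + 1) ^ n ≡ 1 + k * m
[k*k+1]^n≡1+k*m k zero    = 0 , cong suc (sym (*-zeroʳ k))
[k*k+1]^n≡1+k*m k (suc n) with [k*k+1]^n≡1+k*m k n
... | m , eq = k + k * k * m + m , trans (cong (_*_ (k * k + 1)) eq) (step k m)
  where
  step : ∀ k m → (k * k + 1) * (1 + k * m) ≡ 1 + k * (k + k * k * m + m)
  step k m = solve (k ∷ m ∷ [])

cubic<[k*k+1]^n : ∀ {k n} → 2 ≤ k → (k * k + 1 ≡ 5 → 3 ≤ n) → 2 ≤ n →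
  k * k * k + 5 * k * k + 2 * k + 2 < (k * k + 1) ^ n
cubic<[k*k+1]^n {1} (s≤s ())
cubic<[k*k+1]^n {2}             {n} _ 3≤n _   = ≤-trans (≤ᵇ⇒≤ 35 125 tt) (^-monoʳ-≤ 5 (3≤n refl))
cubic<[k*k+1]^n {k@(suc (suc (suc j)))} {n} _ _ 2≤n = begin-strict
  k * k * k + 5 * k * k + 2 * k + 2
    <⟨ m<m+n _ {suc (19 + 61 * j + 42 * j * j + 11 * j * j * j + j * j * j * j)} z<s ⟩
  k * k * k + 5 * k * k + 2 * k + 2 + suc (19 + 61 * j + 42 * j * j + 11 * j * j * j + j * j * j * j)
    ≡⟨ solve (j ∷ []) ⟩
  (k * k + 1) * (k * k + 1)  ≡⟨ cong (_*_ (k * k + 1)) (sym (*-identityʳ (k * k + 1))) ⟩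
  (k * k + 1) ^ 2  ≤⟨ ^-monoʳ-≤ (k * k + 1) 2≤n ⟩
  (k * k + 1) ^ n  ∎
  where open ≤-Reasoning

ceiling-frac-remainder : ∀ {k d P c r} → 1 ≤ k → 1 ≤ d → d * P ≡ k * c + r →
  k * k + d < d * r → d * r ≤ k * k + d * k + d →
  ceiling (frac (P * d) k - frac (k * k + d) (k * d)) ≡ + suc c
ceiling-frac-remainder {k} {d} {P} {c} {r} 1≤k 1≤d dP≡kc+r b<dr dr≤C =
  ceiling-frac-sub 1≤k 1≤d
    (subst (k * d * c + (k * k + d) <_) (sym Pdd≡kdc+dr) (+-monoʳ-< (k * d * c) b<dr))
    (begin
      P * d * d                              ≡⟨ Pdd≡kdc+dr ⟩
      k * d * c + d * r                      ≤⟨ +-monoʳ-≤ (k * d * c) dr≤C ⟩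
      k * d * c + (k * k + d * k + d)        ≡⟨ solve (k ∷ d ∷ c ∷ []) ⟩
      k * d * c + k * d + (k * k + d)        ∎)
  where
  open ≤-Reasoning
  Pdd≡kdc+dr : P * d * d ≡ k * d * c + d * r
  Pdd≡kdc+dr = begin-equality
    P * d * d          ≡⟨ solve (d ∷ P ∷ []) ⟩
    d * (d * P)        ≡⟨ cong (_*_ d) dP≡kc+r ⟩
    d * (k * c + r)    ≡⟨ solve (k ∷ d ∷ c ∷ r ∷ []) ⟩
    k * d * c + d * r  ∎

ceiling≡1+a₂ : ∀ {k d l a} → 2 ≤ k → 1 ≤ d → d ≤ k → (k * k + d ≡ 5 → 3 ≤ l) → 2 ≤ l →
  IsTrott (k * k + d) a → numDigits (k * k + d) (a 2) ≡ l →
  ceiling (frac ((k * k + d) ^ l * d) k - frac (k * k + d) (k * d)) ≡ + suc (a 2)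
ceiling≡1+a₂ {k} {d} {l} {a} 2≤k 1≤d d≤k b≡5⇒3≤l 2≤l trott@(a-pos , _) refl =
  ceiling-frac-remainder 1≤k 1≤d dP≡kc+r
    (k*k+d<dr 2≤k d≤k 1≤c (s≤s z≤n) dP≡kc+r (remainder-lower {k} {d} {P} {c} {r} dP≡kc+r upper))
    (d*r≤k*k+d*k+d 2≤k 1≤d d≤k b²≤P (numDigits-lower b c 1≤c) P≡1[k] P-large dP≡kc+r
      (remainder-upper {k} {d} {P} {c} {r} dP≡kc+r lower))
  where
  b = k * k + d
  P = b ^ l
  c = a 2
  1≤k : 1 ≤ k
  1≤k = ≤-trans (s≤s z≤n) 2≤k
  1≤c : 1 ≤ c
  1≤c = a-pos 2 (s≤s z≤n)
  2≤b : 2 ≤ b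
  2≤b = ≤-trans (s≤s (s≤s z≤n)) (+-mono-≤ (*-mono-≤ 2≤k 2≤k) 1≤d)
  instance _ = >-nonZero (≤-trans (s≤s z≤n) 2≤b)
  a₁≡k×B≡b : a 1 ≡ k × b ^ numDigits b (a 1) ≡ b
  a₁≡k×B≡b = first-quotient 2≤k (+-monoʳ-≤ (k * k) 1≤d) (+-monoʳ-≤ (k * k) d≤k) trott
  upper : (k * P + c) * (k * (c + 1) + 1) ≤ (c + 1) * (b * P)
  upper = subst₂ (λ x B → (x * P + c) * (x * (c + 1) + 1) ≤ (c + 1) * (B * P))
                 (proj₁ a₁≡k×B≡b) (proj₂ a₁≡k×B≡b) (trott-upper 2≤b trott)
  lower : c * (b * P) ≤ (k * P + c + 1) * (k * c + 1)
  lower = subst₂ (λ x B → c * (B * P) ≤ (x * P + c + 1) * (x * c + 1))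
                 (proj₁ a₁≡k×B≡b) (proj₂ a₁≡k×B≡b) (trott-lower 2≤b trott)
  remainder : ∃ λ o → suc (k * c) + o ≡ d * P
  remainder = m≤n⇒∃[o]m+o≡n (kc<dP 1≤k (m^n>0 b l) upper)
  r = suc (proj₁ remainder)
  dP≡kc+r : d * P ≡ k * c + r
  dP≡kc+r = trans (sym (proj₂ remainder)) (sym (+-suc (k * c) (proj₁ remainder)))
  b²≤P : b * b ≤ P
  b²≤P = subst (_≤ P) (cong (_*_ b) (*-identityʳ b)) (^-monoʳ-≤ b 2≤l)
  P≡1[k] : d ≡ 1 → ∃ λ m → P ≡ 1 + k * m
  P≡1[k] d≡1 = subst (λ x → ∃ λ m → (k * k + x) ^ l ≡ 1 + k * m) (sym d≡1) ([k*k+1]^n≡1+k*m k l)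
  P-large : d ≡ 1 → k * k * k + 5 * k * k + 2 * k + 2 < P
  P-large d≡1 = subst (λ x → k * k * k + 5 * k * k + 2 * k + 2 < (k * k + x) ^ l) (sym d≡1)
    (cubic<[k*k+1]^n 2≤k (λ k²+1≡5 → b≡5⇒3≤l (trans (cong (_+_ (k * k)) d≡1) k²+1≡5)) 2≤l)

lemma6p1 : (k b l : ℕ) (a : ℕ → ℕ) →
    2 ≤ k → k * k + 1 ≤ b → b ≤ k * k + k →
    (b ≡ 5 → 3 ≤ l) → (b ≢ 5 → 2 ≤ l) →
    IsTrott b a → numDigits b (a 2) ≡ l →
    + (a 2) ≡ ceiling (frac (b ^ l * (b ∸ k * k)) k - frac b (k * (b ∸ k * k))) -ℤ + 1
lemma6p1 k b l a 2≤k k²+1≤b b≤k²+k b≡5⇒3≤l b≢5⇒2≤l trott #a₂≡l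
  with m≤n⇒∃[o]m+o≡n (≤-trans (m≤m+n (k * k) 1) k²+1≤b)
... | d , refl rewrite m+n∸m≡n (k * k) d =
  cong (_-ℤ + 1) (sym (ceiling≡1+a₂ 2≤k (+-cancelˡ-≤ (k * k) 1 d k²+1≤b) (+-cancelˡ-≤ (k * k) d k b≤k²+k)
                        b≡5⇒3≤l 2≤l trott #a₂≡l))
  where
  2≤l : 2 ≤ l
  2≤l with k * k + d ≟ 5
  ... | yes b≡5 = ≤-trans (n≤1+n 2) (b≡5⇒3≤l b≡5)
  ... | no  b≢5 = b≢5⇒2≤l b≢5
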